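{- Let $n,d$ be positive integers with $d<\frac{n+1}{2}$. Then the sequence $(m_0,m_1,\dots,m_d)$ of multiplicities of the Johnson scheme $J(n,d)$, given by $m_i=\binom{n}{i}-\binom{n}{i-1}$ (with $\binom{n}{ -1}=0$), is log-concave.
   Context: The Johnson scheme $J(n,d)$ is the association scheme on the $d$-subsets of an $n$-set, with two subsets in relation $R_i$ iff their intersection has size $d-i$; in its standard (Q-polynomial) ordering of eigenspaces the multiplicities are $m_i=\binom{n}{i}-\binom{n}{i-1}$, $0\le i\le d$. A sequence $(s_0,\dots,s_d)$ is log-concave if $s_i^2\ge s_{i-1}s_{i+1}$ for all $1\le i\le d-1$. -}

module Defs where

open import Data.Nat using (ℕ; zero; suc)
open import Data.Nat.Combinatorics using (_C_)
open import Data.Integer using (ℤ; +_; _-_)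

binomPred : ℕ → ℕ → ℕ
binomPred n zero    = 0
binomPred n (suc i) = n C i

mult : ℕ → ℕ → ℤ
mult n i = + (n C i) - + (binomPred n i)

{-# OPTIONS --safe #-}
-- Absorption gives (n+1)·m_j = (n+1-2j)·C(n+1,j), so up to the constant factor n+1 the
-- multiplicities are the product of the binomial coefficients C(n+1,j) and the linear
-- sequence n+1-2j. Both are log-concave (the binomial coefficients because their
-- successive ratios (n+1-j)/(j+1) decrease), and a product of nonnegative log-concave
-- sequences is log-concave. For 2j ≤ n+1 all terms are nonnegative, so this transfers to ℤ.
module Submission where

open import Defs
open import Data.Nat using (ℕ; zero; suc; _+_; _*_; _∸_; _≤_; _<_; z≤n; s≤s; _≤?_; _<?_;
                            NonZero; >-nonZero)
open import Data.Nat.Properties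
open import Data.Nat.Combinatorics using (_C_; nC1≡n; k>n⇒nCk≡0; nCk+nC[k+1]≡[n+1]C[k+1])
open import Data.Nat.Tactic.RingSolver using (solve-∀)
open import Algebra.Properties.CommutativeSemigroup *-commutativeSemigroup using (interchange)
open import Data.Integer using (+_; +≤+) renaming (_*_ to _*ℤ_; _≤_ to _≤ℤ_)
import Data.Integer.Properties as ℤ
open import Relation.Nullary using (yes; no)
open import Relation.Binary.PropositionalEquality

LogConcaveAt : (ℕ → ℕ) → ℕ → Set
LogConcaveAt f k = f k * f (2 + k) ≤ f (1 + k) * f (1 + k)

logConcaveAt-resp : ∀ (f g : ℕ → ℕ) k → (∀ j → f j ≡ g j) → LogConcaveAt f k → LogConcaveAt g k
logConcaveAt-resp f g k f≗g =
  subst₂ _≤_ (cong₂ _*_ (f≗g k) (f≗g (2 + k))) (cong₂ _*_ (f≗g (1 + k)) (f≗g (1 + k)))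

logConcaveAt-* : ∀ (f g : ℕ → ℕ) k → LogConcaveAt f k → LogConcaveAt g k →
                 LogConcaveAt (λ j → f j * g j) k
logConcaveAt-* f g k f-lc g-lc = begin
    f k * g k * (f (2 + k) * g (2 + k))      ≡⟨ interchange (f k) (g k) (f (2 + k)) (g (2 + k)) ⟩
    f k * f (2 + k) * (g k * g (2 + k))      ≤⟨ *-mono-≤ f-lc g-lc ⟩
    f (1 + k) * f (1 + k) * (g (1 + k) * g (1 + k))
      ≡⟨ interchange (f (1 + k)) (f (1 + k)) (g (1 + k)) (g (1 + k)) ⟩
    f (1 + k) * g (1 + k) * (f (1 + k) * g (1 + k)) ∎
  where open ≤-Reasoning

logConcaveAt-cancel-*ˡ : ∀ c .{{_ : NonZero c}} (f : ℕ → ℕ) k →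
                         LogConcaveAt (λ j → c * f j) k → LogConcaveAt f k
logConcaveAt-cancel-*ˡ c f k cf-lc = *-cancelˡ-≤ (c * c) {{m*n≢0 c c}}
  (subst₂ _≤_ (interchange c (f k) c (f (2 + k)))
              (interchange c (f (1 + k)) c (f (1 + k))) cf-lc)

logConcaveAt-vanishing : ∀ (f : ℕ → ℕ) k → f (2 + k) ≡ 0 → LogConcaveAt f k
logConcaveAt-vanishing f k f[2+k]≡0 = begin
  f k * f (2 + k) ≡⟨ cong (f k *_) f[2+k]≡0 ⟩
  f k * 0         ≡⟨ *-zeroʳ (f k) ⟩
  0               ≤⟨ z≤n ⟩
  f (1 + k) * f (1 + k) ∎
  where open ≤-Reasoning

decreasing-ratios⇒logConcaveAt : ∀ (f p q : ℕ → ℕ) k .{{_ : NonZero (q (1 + k) * p k)}} →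
  (∀ j → q j * f (1 + j) ≡ p j * f j) → q k * p (1 + k) ≤ q (1 + k) * p k →
  LogConcaveAt f k
decreasing-ratios⇒logConcaveAt f p q k ratio ratio-antitone = *-cancelˡ-≤ (s * p k) (begin
    s * p k * (a * c)         ≡⟨ rearrange s (p k) a c ⟩
    p k * a * (s * c)         ≡⟨ cong₂ _*_ (sym (ratio k)) (ratio (1 + k)) ⟩
    q k * b * (p (1 + k) * b) ≡⟨ interchange (q k) b (p (1 + k)) b ⟩
    q k * p (1 + k) * (b * b) ≤⟨ *-monoˡ-≤ (b * b) ratio-antitone ⟩
    s * p k * (b * b)         ∎)
  where
  open ≤-Reasoning
  a = f k
  b = f (1 + k)
  c = f (2 + k)
  s = q (1 + k)
  rearrange : ∀ s p a c → s * p * (a * c) ≡ p * a * (s * c)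
  rearrange = solve-∀

∸-*-logConcaveAt : ∀ N c k → LogConcaveAt (λ j → N ∸ c * j) k
∸-*-logConcaveAt N c k with c * (2 + k) ≤? N
... | no  c[2+k]≰N =
  logConcaveAt-vanishing (λ j → N ∸ c * j) k (m≤n⇒m∸n≡0 (<⇒≤ (≰⇒> c[2+k]≰N)))
... | yes c[2+k]≤N = begin
    (N ∸ c * k) * (N ∸ c * (2 + k))       ≡⟨ cong₂ _*_ (N∸c*j≡ k (c + c + x) (offset₀ c k x))
                                                        (N∸c*j≡ (2 + k) x refl) ⟩
    (c + c + x) * x                       ≤⟨ m≤m+n _ (c * c) ⟩
    (c + c + x) * x + c * c               ≡⟨ square c x ⟩
    (c + x) * (c + x)                     ≡⟨ cong₂ _*_ (sym N∸c[1+k]≡c+x) (sym N∸c[1+k]≡c+x) ⟩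
    (N ∸ c * (1 + k)) * (N ∸ c * (1 + k)) ∎
  where
  open ≤-Reasoning
  x = N ∸ c * (2 + k)
  N∸c*j≡ : ∀ j y → c * j + y ≡ c * (2 + k) + x → N ∸ c * j ≡ y
  N∸c*j≡ j y eq = begin-equality
    N ∸ c * j                        ≡⟨ cong (_∸ c * j) (sym (m+[n∸m]≡n c[2+k]≤N)) ⟩
    c * (2 + k) + x ∸ c * j          ≡⟨ cong (_∸ c * j) (sym eq) ⟩
    c * j + y ∸ c * j                ≡⟨ m+n∸m≡n (c * j) y ⟩
    y                                ∎
  offset₀ : ∀ c k x → c * k + (c + c + x) ≡ c * (2 + k) + x
  offset₀ = solve-∀
  offset₁ : ∀ c k x → c * (1 + k) + (c + x) ≡ c * (2 + k) + x
  offset₁ = solve-∀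
  N∸c[1+k]≡c+x : N ∸ c * (1 + k) ≡ c + x
  N∸c[1+k]≡c+x = N∸c*j≡ (1 + k) (c + x) (offset₁ c k x)
  square : ∀ c x → (c + c + x) * x + c * c ≡ (c + x) * (c + x)
  square = solve-∀

binomPred+nCj≡[n+1]Cj : ∀ n j → binomPred n j + n C j ≡ suc n C j
binomPred+nCj≡[n+1]Cj n zero    = refl
binomPred+nCj≡[n+1]Cj n (suc j) = nCk+nC[k+1]≡[n+1]C[k+1] n j

[k+1]*[n+1]C[k+1]≡[n+1]*nCk : ∀ n k → suc k * (suc n C suc k) ≡ suc n * (n C k)
[k+1]*[n+1]C[k+1]≡[n+1]*nCk zero    zero    = refl
[k+1]*[n+1]C[k+1]≡[n+1]*nCk zero    (suc k) = *-zeroʳ (2 + k)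
[k+1]*[n+1]C[k+1]≡[n+1]*nCk (suc n) zero    =
  trans (+-identityʳ _) (trans (nC1≡n (2 + n)) (sym (*-identityʳ (2 + n))))
[k+1]*[n+1]C[k+1]≡[n+1]*nCk (suc n) (suc k) = begin
  (2 + k) * ((2 + n) C (2 + k))
    ≡⟨ cong ((2 + k) *_) (nCk+nC[k+1]≡[n+1]C[k+1] (suc n) (suc k)) ⟨
  (2 + k) * ((1 + n) C (1 + k) + (1 + n) C (2 + k))
    ≡⟨ split ((1 + n) C (1 + k)) ((1 + n) C (2 + k)) k ⟩
  (1 + n) C (1 + k) + (1 + k) * ((1 + n) C (1 + k)) + (2 + k) * ((1 + n) C (2 + k))
    ≡⟨ cong₂ (λ a b → (1 + n) C (1 + k) + a + b)
             ([k+1]*[n+1]C[k+1]≡[n+1]*nCk n k) ([k+1]*[n+1]C[k+1]≡[n+1]*nCk n (suc k)) ⟩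
  (1 + n) C (1 + k) + (1 + n) * (n C k) + (1 + n) * (n C (1 + k))
    ≡⟨ join ((1 + n) C (1 + k)) (n C k) (n C (1 + k)) n ⟩
  (1 + n) C (1 + k) + (1 + n) * (n C k + n C (1 + k))
    ≡⟨ cong (λ b → (1 + n) C (1 + k) + (1 + n) * b) (nCk+nC[k+1]≡[n+1]C[k+1] n k) ⟩
  (2 + n) * ((1 + n) C (1 + k)) ∎
  where
  open ≡-Reasoning
  split : ∀ a b k → (2 + k) * (a + b) ≡ a + (1 + k) * a + (2 + k) * b
  split = solve-∀
  join : ∀ a b c n → a + (1 + n) * b + (1 + n) * c ≡ a + (1 + n) * (b + c)
  join = solve-∀

j*[n+1]Cj≡[n+1]*binomPred : ∀ n j → j * (suc n C j) ≡ suc n * binomPred n j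
j*[n+1]Cj≡[n+1]*binomPred n zero    = sym (*-zeroʳ n)
j*[n+1]Cj≡[n+1]*binomPred n (suc j) = [k+1]*[n+1]C[k+1]≡[n+1]*nCk n j

[n+1∸j]*[n+1]Cj≡[n+1]*nCj : ∀ n j → (suc n ∸ j) * (suc n C j) ≡ suc n * (n C j)
[n+1∸j]*[n+1]Cj≡[n+1]*nCj n j = begin
  (suc n ∸ j) * (suc n C j)                        ≡⟨ *-distribʳ-∸ (suc n C j) (suc n) j ⟩
  suc n * (suc n C j) ∸ j * (suc n C j)             ≡⟨ cong (_∸ j * (suc n C j)) expand ⟩
  j * (suc n C j) + suc n * (n C j) ∸ j * (suc n C j) ≡⟨ m+n∸m≡n (j * (suc n C j)) _ ⟩
  suc n * (n C j)                                  ∎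
  where
  open ≡-Reasoning
  expand : suc n * (suc n C j) ≡ j * (suc n C j) + suc n * (n C j)
  expand = begin
    suc n * (suc n C j)                       ≡⟨ cong (suc n *_) (binomPred+nCj≡[n+1]Cj n j) ⟨
    suc n * (binomPred n j + n C j)           ≡⟨ *-distribˡ-+ (suc n) (binomPred n j) (n C j) ⟩
    suc n * binomPred n j + suc n * (n C j)   ≡⟨ cong (_+ suc n * (n C j)) (j*[n+1]Cj≡[n+1]*binomPred n j) ⟨
    j * (suc n C j) + suc n * (n C j)         ∎

[k+1]*NC[k+1]≡[N∸k]*NCk : ∀ N k → suc k * (N C suc k) ≡ (N ∸ k) * (N C k)
[k+1]*NC[k+1]≡[N∸k]*NCk zero    k = trans (*-zeroʳ (suc k)) (sym (cong (_* (0 C k)) (0∸n≡0 k)))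
[k+1]*NC[k+1]≡[N∸k]*NCk (suc n) k =
  trans ([k+1]*[n+1]C[k+1]≡[n+1]*nCk n k) (sym ([n+1∸j]*[n+1]Cj≡[n+1]*nCj n k))

C-logConcaveAt : ∀ N k → LogConcaveAt (N C_) k
C-logConcaveAt N k with k <? N
... | no  k≮N = logConcaveAt-vanishing (N C_) k (k>n⇒nCk≡0 (s≤s (m≤n⇒m≤1+n (≮⇒≥ k≮N))))
... | yes k<N = decreasing-ratios⇒logConcaveAt (N C_) (N ∸_) suc k
  {{m*n≢0 (2 + k) (N ∸ k) {{_}} {{>-nonZero (m<n⇒0<n∸m k<N)}}}}
  ([k+1]*NC[k+1]≡[N∸k]*NCk N) (*-mono-≤ (n≤1+n (suc k)) (∸-monoʳ-≤ N (n≤1+n k)))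

-- The truncated subtraction agrees with mult n j only while binomPred n j ≤ n C j,
-- i.e. for 2j ≤ n+1.
multℕ : ℕ → ℕ → ℕ
multℕ n j = n C j ∸ binomPred n j

suc-*-multℕ : ∀ n j → suc n * multℕ n j ≡ (suc n ∸ 2 * j) * (suc n C j)
suc-*-multℕ n j = begin
  suc n * (n C j ∸ binomPred n j)                   ≡⟨ *-distribˡ-∸ (suc n) (n C j) (binomPred n j) ⟩
  suc n * (n C j) ∸ suc n * binomPred n j           ≡⟨ cong₂ _∸_ ([n+1∸j]*[n+1]Cj≡[n+1]*nCj n j)
                                                                (j*[n+1]Cj≡[n+1]*binomPred n j) ⟨
  (suc n ∸ j) * (suc n C j) ∸ j * (suc n C j)       ≡⟨ *-distribʳ-∸ (suc n C j) (suc n ∸ j) j ⟨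
  (suc n ∸ j ∸ j) * (suc n C j)                     ≡⟨ cong (_* (suc n C j)) (∸-+-assoc (suc n) j j) ⟩
  (suc n ∸ (j + j)) * (suc n C j)
    ≡⟨ cong (λ i → (suc n ∸ (j + i)) * (suc n C j)) (+-identityʳ j) ⟨
  (suc n ∸ 2 * j) * (suc n C j)                     ∎
  where open ≡-Reasoning

multℕ-logConcaveAt : ∀ n k → LogConcaveAt (multℕ n) k
multℕ-logConcaveAt n k = logConcaveAt-cancel-*ˡ (suc n) (multℕ n) k
  (logConcaveAt-resp (λ j → (suc n ∸ 2 * j) * (suc n C j)) (λ j → suc n * multℕ n j) k
    (λ j → sym (suc-*-multℕ n j))
    (logConcaveAt-* (λ j → suc n ∸ 2 * j) (suc n C_) k
      (∸-*-logConcaveAt (suc n) 2 k) (C-logConcaveAt (suc n) k)))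

binomPred≤C : ∀ n j → 2 * j ≤ suc n → binomPred n j ≤ n C j
binomPred≤C n j 2j≤suc-n = *-cancelˡ-≤ (suc n) (begin
  suc n * binomPred n j      ≡⟨ j*[n+1]Cj≡[n+1]*binomPred n j ⟨
  j * (suc n C j)            ≤⟨ *-monoˡ-≤ (suc n C j) j≤suc-n∸j ⟩
  (suc n ∸ j) * (suc n C j)  ≡⟨ [n+1∸j]*[n+1]Cj≡[n+1]*nCj n j ⟩
  suc n * (n C j)            ∎)
  where
  open ≤-Reasoning
  j≤suc-n∸j : j ≤ suc n ∸ j
  j≤suc-n∸j = m+n≤o⇒m≤o∸n j (subst (_≤ suc n) (cong (λ i → j + i) (+-identityʳ j)) 2j≤suc-n)

mult≡+multℕ : ∀ n j → 2 * j ≤ suc n → mult n j ≡ + multℕ n j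
mult≡+multℕ n j 2j≤suc-n =
  trans (ℤ.[+m]-[+n]≡m⊖n (n C j) (binomPred n j)) (ℤ.⊖-≥ (binomPred≤C n j 2j≤suc-n))

mult-logConcaveAt : ∀ n k → 2 * (2 + k) ≤ suc n →
  mult n k *ℤ mult n (2 + k) ≤ℤ mult n (1 + k) *ℤ mult n (1 + k)
mult-logConcaveAt n k 2[2+k]≤suc-n = begin
  mult n k *ℤ mult n (2 + k)
    ≡⟨ cong₂ _*ℤ_ (as-multℕ k (m≤n+m k 2)) (as-multℕ (2 + k) ≤-refl) ⟩
  + multℕ n k *ℤ + multℕ n (2 + k)                ≡⟨ ℤ.pos-* (multℕ n k) (multℕ n (2 + k)) ⟨
  + (multℕ n k * multℕ n (2 + k))                 ≤⟨ +≤+ (multℕ-logConcaveAt n k) ⟩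
  + (multℕ n (1 + k) * multℕ n (1 + k))           ≡⟨ ℤ.pos-* (multℕ n (1 + k)) (multℕ n (1 + k)) ⟩
  + multℕ n (1 + k) *ℤ + multℕ n (1 + k)          ≡⟨ cong₂ _*ℤ_ mult[1+k] mult[1+k] ⟨
  mult n (1 + k) *ℤ mult n (1 + k)                ∎
  where
  open ℤ.≤-Reasoning
  as-multℕ : ∀ j → j ≤ 2 + k → mult n j ≡ + multℕ n j
  as-multℕ j j≤2+k = mult≡+multℕ n j (≤-trans (*-monoʳ-≤ 2 j≤2+k) 2[2+k]≤suc-n)
  mult[1+k] : mult n (1 + k) ≡ + multℕ n (1 + k)
  mult[1+k] = as-multℕ (1 + k) (n≤1+n (1 + k))

theorem6 : (n d : ℕ) → 1 ≤ n → 1 ≤ d → 2 * d < suc n →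
    (i : ℕ) → 1 ≤ i → suc i ≤ d →
    mult n (i ∸ 1) *ℤ mult n (suc i) ≤ℤ mult n i *ℤ mult n i
theorem6 n d _ _ _ zero () _
theorem6 n d _ _ 2d<suc-n (suc k) _ suc-i≤d =
  mult-logConcaveAt n k (≤-trans (*-monoʳ-≤ 2 suc-i≤d) (<⇒≤ 2d<suc-n))
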